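{- Let $\Sigma$ be the set of all MAV structures, preordered by $P\le Q$ iff there is a normal derivation $P\longrightarrow^*Q$. The quotient poset of this preorder, equipped with $⅋$, $;$, unit $\mathbf 1$, and $+:=\&$, i.e. $(\Sigma,\longrightarrow^*,⅋,;,\mathbf 1,\&)$, is an MAV-frame.
   Context: MAV structures $P ::= a \mid a^\perp \mid \mathbf{1} \mid P;Q \mid P\otimes Q \mid P⅋Q \mid P\& Q \mid P\oplus Q$ over a set of atoms, taken modulo the least congruence making $(;,\mathbf 1)$ a monoid and $(\otimes,\mathbf 1),(⅋,\mathbf 1)$ commutative monoids. Normal one-step inference is the least relation closed under one-hole contexts ($P\to Q$ implies $C[P]\to C[Q]$) containing: AtomInteract $a^\perp⅋a\to\mathbf 1$; Switch $(P\otimes Q)⅋R\to P\otimes(Q⅋R)$; Tidy $\mathbf 1\&\mathbf 1\to\mathbf 1$; Sequence $(P;Q)⅋(R;S)\to(P⅋R);(Q⅋S)$; Left $P\oplus Q\to P$; Right $P\oplus Q\to Q$; External $(P\&Q)⅋R\to(P⅋R)\&(Q⅋R)$; Medial $(P;Q)\&(R;S)\to(P\&R);(Q\&S)$. A normal derivation is a finite sequence of such steps (reflexive–transitive closure). An MAV-frame is $(F,\le,⅋,\lhd,i,+)$ where $(F,\le)$ is a poset, $(⅋,i)$ a commutative monoid with $⅋$ monotone, $(\lhd,i)$ a monoid with $\lhd$ monotone, $+$ a monotone binary operation, satisfying $(w\lhd x)⅋(y\lhd z)\le(w⅋y)\lhd(x⅋z)$, $(x+y)⅋z\le(x⅋z)+(y⅋z)$,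 $(w\lhd x)+(y\lhd z)\le(w+y)\lhd(x+z)$, $i+i\le i$. -}

module Defs where

open import Level using (Level; _⊔_; suc)
open import Data.Product using (_×_)
open import Relation.Binary.Core using (Rel)
open import Relation.Binary.Structures using (IsPartialOrder)
open import Algebra.Core using (Op₂)
open import Algebra.Structures using (IsMonoid; IsCommutativeMonoid)

infixr 6 _；_
infixr 5 _⊗_ _⅋_ _&_ _⊕_

data Str {a} (A : Set a) : Set a where
  atom  : A → Str A
  natom : A → Str A
  𝟙     : Str A
  _；_  : Str A → Str A → Str A
  _⊗_   : Str A → Str A → Str A
  _⅋_   : Str A → Str A → Str A
  _&_   : Str A → Str A → Str A
  _⊕_   : Str A → Str A → Str A

module _ {a} {A : Set a} where

  infix 4 _≡ˢ_ _⟶_ _⟶*_ _≃_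

  data _≡ˢ_ : Str A → Str A → Set a where
    ≡-refl  : ∀ {P} → P ≡ˢ P
    ≡-sym   : ∀ {P Q} → P ≡ˢ Q → Q ≡ˢ P
    ≡-trans : ∀ {P Q R} → P ≡ˢ Q → Q ≡ˢ R → P ≡ˢ R
    ；-cong : ∀ {P P' Q Q'} → P ≡ˢ P' → Q ≡ˢ Q' → (P ； Q) ≡ˢ (P' ； Q')
    ⊗-cong  : ∀ {P P' Q Q'} → P ≡ˢ P' → Q ≡ˢ Q' → (P ⊗ Q) ≡ˢ (P' ⊗ Q')
    ⅋-cong  : ∀ {P P' Q Q'} → P ≡ˢ P' → Q ≡ˢ Q' → (P ⅋ Q) ≡ˢ (P' ⅋ Q')
    &-cong  : ∀ {P P' Q Q'} → P ≡ˢ P' → Q ≡ˢ Q' → (P & Q) ≡ˢ (P' & Q')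
    ⊕-cong  : ∀ {P P' Q Q'} → P ≡ˢ P' → Q ≡ˢ Q' → (P ⊕ Q) ≡ˢ (P' ⊕ Q')
    ；-assoc  : ∀ {P Q R} → ((P ； Q) ； R) ≡ˢ (P ； (Q ； R))
    ；-unitˡ  : ∀ {P} → (𝟙 ； P) ≡ˢ P
    ；-unitʳ  : ∀ {P} → (P ； 𝟙) ≡ˢ P
    ⊗-assoc  : ∀ {P Q R} → ((P ⊗ Q) ⊗ R) ≡ˢ (P ⊗ (Q ⊗ R))
    ⊗-comm   : ∀ {P Q} → (P ⊗ Q) ≡ˢ (Q ⊗ P)
    ⊗-unitʳ  : ∀ {P} → (P ⊗ 𝟙) ≡ˢ P
    ⅋-assoc  : ∀ {P Q R} → ((P ⅋ Q) ⅋ R) ≡ˢ (P ⅋ (Q ⅋ R))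
    ⅋-comm   : ∀ {P Q} → (P ⅋ Q) ≡ˢ (Q ⅋ P)
    ⅋-unitʳ  : ∀ {P} → (P ⅋ 𝟙) ≡ˢ P

  data _⟶_ : Str A → Str A → Set a where
    atom-interact : ∀ {x} → (natom x ⅋ atom x) ⟶ 𝟙
    switch   : ∀ {P Q R} → ((P ⊗ Q) ⅋ R) ⟶ (P ⊗ (Q ⅋ R))
    tidy     : (𝟙 & 𝟙) ⟶ 𝟙
    sequence : ∀ {P Q R S} → ((P ； Q) ⅋ (R ； S)) ⟶ ((P ⅋ R) ； (Q ⅋ S))
    left     : ∀ {P Q} → (P ⊕ Q) ⟶ P
    right    : ∀ {P Q} → (P ⊕ Q) ⟶ Q
    external : ∀ {P Q R} → ((P & Q) ⅋ R) ⟶ ((P ⅋ R) & (Q ⅋ R))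
    medial   : ∀ {P Q R S} → ((P ； Q) & (R ； S)) ⟶ ((P & R) ； (Q & S))
    ；ˡ : ∀ {P P' Q} → P ⟶ P' → (P ； Q) ⟶ (P' ； Q)
    ；ʳ : ∀ {P Q Q'} → Q ⟶ Q' → (P ； Q) ⟶ (P ； Q')
    ⊗ˡ : ∀ {P P' Q} → P ⟶ P' → (P ⊗ Q) ⟶ (P' ⊗ Q)
    ⊗ʳ : ∀ {P Q Q'} → Q ⟶ Q' → (P ⊗ Q) ⟶ (P ⊗ Q')
    ⅋ˡ : ∀ {P P' Q} → P ⟶ P' → (P ⅋ Q) ⟶ (P' ⅋ Q)
    ⅋ʳ : ∀ {P Q Q'} → Q ⟶ Q' → (P ⅋ Q) ⟶ (P ⅋ Q')
    &ˡ : ∀ {P P' Q} → P ⟶ P' → (P & Q) ⟶ (P' & Q)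
    &ʳ : ∀ {P Q Q'} → Q ⟶ Q' → (P & Q) ⟶ (P & Q')
    ⊕ˡ : ∀ {P P' Q} → P ⟶ P' → (P ⊕ Q) ⟶ (P' ⊕ Q)
    ⊕ʳ : ∀ {P Q Q'} → Q ⟶ Q' → (P ⊕ Q) ⟶ (P ⊕ Q')

  -- Normal derivations: reflexive-transitive closure of one-step
  -- inference on structures taken modulo ≡ˢ.

  data _⟶*_ : Str A → Str A → Set a where
    by-≡  : ∀ {P Q} → P ≡ˢ Q → P ⟶* Q
    by-⟶ : ∀ {P Q} → P ⟶ Q → P ⟶* Q
    _then_ : ∀ {P Q R} → P ⟶* Q → Q ⟶* R → P ⟶* R

  _≃_ : Str A → Str A → Set a
  P ≃ Q = (P ⟶* Q) × (Q ⟶* P)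

-- MAV-frames. A poset (F, ≤) is represented by a carrier with an
-- equivalence _≈_ (the equality of the poset) and a partial order _≤_
-- with respect to it; all algebraic laws hold up to _≈_.

record IsMAVFrame {c ℓ₁ ℓ₂} {F : Set c} (_≈_ : Rel F ℓ₁) (_≤_ : Rel F ℓ₂)
                  (_⅋_ : Op₂ F) (_◁_ : Op₂ F) (i : F) (_+_ : Op₂ F)
                  : Set (c ⊔ ℓ₁ ⊔ ℓ₂) where
  field
    isPartialOrder        : IsPartialOrder _≈_ _≤_
    ⅋-isCommutativeMonoid : IsCommutativeMonoid _≈_ _⅋_ i
    ◁-isMonoid            : IsMonoid _≈_ _◁_ i
    ⅋-mono : ∀ {x y u v} → x ≤ y → u ≤ v → (x ⅋ u) ≤ (y ⅋ v)
    ◁-mono : ∀ {x y u v} → x ≤ y → u ≤ v → (x ◁ u) ≤ (y ◁ v)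
    +-mono : ∀ {x y u v} → x ≤ y → u ≤ v → (x + u) ≤ (y + v)
    ⅋-◁    : ∀ w x y z → ((w ◁ x) ⅋ (y ◁ z)) ≤ ((w ⅋ y) ◁ (x ⅋ z))
    +-⅋    : ∀ x y z → ((x + y) ⅋ z) ≤ ((x ⅋ z) + (y ⅋ z))
    +-◁    : ∀ w x y z → ((w ◁ x) + (y ◁ z)) ≤ ((w + y) ◁ (x + z))
    i+i    : (i + i) ≤ i

{-# OPTIONS --safe #-}

-- Every connective respects ≡ˢ and has a one-hole context rule in each argument, so
-- rewriting one argument and then the other makes it monotone for ⟶*, and monotone
-- operations descend to the quotient by mutual derivability. The monoid laws hold
-- already up to ≡ˢ, and the four frame inequalities are single instances of the rules
-- Sequence, External, Medial and Tidy.
module Submission where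

open import Defs
open import Level using (Level)
open import Data.Product using (_,_; proj₁)
open import Relation.Binary.Core using (_Preserves_⟶_; _Preserves₂_⟶_⟶_)
open import Relation.Binary.Bundles using (Preorder; Setoid)
open import Relation.Binary.Structures using (IsEquivalence; IsPreorder; IsPartialOrder)
open import Relation.Binary.Properties.Preorder using (InducedEquivalence)
open import Algebra.Core using (Op₂)
open import Algebra.Structures using (IsMonoid; IsCommutativeMonoid)
open import Algebra.Structures.Biased using (isCommutativeMonoidʳ)

module _ {a : Level} {A : Set a} where

  ⟶*-isPreorder : IsPreorder _≡ˢ_ (_⟶*_ {A = A})
  ⟶*-isPreorder = record
    { isEquivalence = record { refl = ≡-refl ; sym = ≡-sym ; trans = ≡-trans }
    ; reflexive     = by-≡
    ; trans         = _then_
    }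

  ⟶*-preorder : Preorder a a a
  ⟶*-preorder = record { isPreorder = ⟶*-isPreorder }

  ≃-isEquivalence : IsEquivalence (_≃_ {A = A})
  ≃-isEquivalence = Setoid.isEquivalence (InducedEquivalence ⟶*-preorder)

  ⟶*-isPartialOrder : IsPartialOrder _≃_ (_⟶*_ {A = A})
  ⟶*-isPartialOrder = record
    { isPreorder = record
      { isEquivalence = ≃-isEquivalence
      ; reflexive     = proj₁
      ; trans         = _then_
      }
    ; antisym = _,_
    }

  ≡ˢ⇒≃ : ∀ {P Q : Str A} → P ≡ˢ Q → P ≃ Q
  ≡ˢ⇒≃ P≡Q = by-≡ P≡Q , by-≡ (≡-sym P≡Q)

  map-⟶* : (f : Str A → Str A) → f Preserves _≡ˢ_ ⟶ _≡ˢ_ → f Preserves _⟶_ ⟶ _⟶_ →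
           f Preserves _⟶*_ ⟶ _⟶*_
  map-⟶* f f-≡ˢ f-⟶ (by-≡ P≡Q)  = by-≡ (f-≡ˢ P≡Q)
  map-⟶* f f-≡ˢ f-⟶ (by-⟶ P⟶Q)  = by-⟶ (f-⟶ P⟶Q)
  map-⟶* f f-≡ˢ f-⟶ (P⟶*Q then Q⟶*R) = map-⟶* f f-≡ˢ f-⟶ P⟶*Q then map-⟶* f f-≡ˢ f-⟶ Q⟶*R

  record IsContextual (_∙_ : Op₂ (Str A)) : Set a where
    field
      ≡ˢ-cong : _∙_ Preserves₂ _≡ˢ_ ⟶ _≡ˢ_ ⟶ _≡ˢ_
      stepˡ   : ∀ {Q} → (_∙ Q) Preserves _⟶_ ⟶ _⟶_
      stepʳ   : ∀ {P} → (P ∙_) Preserves _⟶_ ⟶ _⟶_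

    mono : _∙_ Preserves₂ _⟶*_ ⟶ _⟶*_ ⟶ _⟶*_
    mono {P} {P′} {Q} {Q′} P⟶*P′ Q⟶*Q′ =
      map-⟶* (_∙ Q) (λ e → ≡ˢ-cong e ≡-refl) stepˡ P⟶*P′ then
      map-⟶* (P′ ∙_) (≡ˢ-cong ≡-refl) stepʳ Q⟶*Q′

    ≃-cong : _∙_ Preserves₂ _≃_ ⟶ _≃_ ⟶ _≃_
    ≃-cong (P⟶*P′ , P′⟶*P) (Q⟶*Q′ , Q′⟶*Q) = mono P⟶*P′ Q⟶*Q′ , mono P′⟶*P Q′⟶*Q

  ⅋-isContextual : IsContextual _⅋_
  ⅋-isContextual = record { ≡ˢ-cong = ⅋-cong ; stepˡ = ⅋ˡ ; stepʳ = ⅋ʳ }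

  ；-isContextual : IsContextual _；_
  ；-isContextual = record { ≡ˢ-cong = ；-cong ; stepˡ = ；ˡ ; stepʳ = ；ʳ }

  &-isContextual : IsContextual _&_
  &-isContextual = record { ≡ˢ-cong = &-cong ; stepˡ = &ˡ ; stepʳ = &ʳ }

  ⅋-𝟙-isCommutativeMonoid : IsCommutativeMonoid _≃_ _⅋_ 𝟙
  ⅋-𝟙-isCommutativeMonoid = isCommutativeMonoidʳ record
    { isSemigroup = record
      { isMagma = record
        { isEquivalence = ≃-isEquivalence
        ; ∙-cong        = IsContextual.≃-cong ⅋-isContextual
        }
      ; assoc = λ _ _ _ → ≡ˢ⇒≃ ⅋-assoc
      }
    ; identityʳ = λ _ → ≡ˢ⇒≃ ⅋-unitʳ
    ; comm      = λ _ _ → ≡ˢ⇒≃ ⅋-comm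
    }

  ；-𝟙-isMonoid : IsMonoid _≃_ _；_ 𝟙
  ；-𝟙-isMonoid = record
    { isSemigroup = record
      { isMagma = record
        { isEquivalence = ≃-isEquivalence
        ; ∙-cong        = IsContextual.≃-cong ；-isContextual
        }
      ; assoc = λ _ _ _ → ≡ˢ⇒≃ ；-assoc
      }
    ; identity = (λ _ → ≡ˢ⇒≃ ；-unitˡ) , (λ _ → ≡ˢ⇒≃ ；-unitʳ)
    }

proposition3p17 : ∀ {a} (A : Set a) → IsMAVFrame (_≃_ {A = A}) (_⟶*_ {A = A}) _⅋_ _；_ 𝟙 _&_
proposition3p17 _ = record
  { isPartialOrder        = ⟶*-isPartialOrder
  ; ⅋-isCommutativeMonoid = ⅋-𝟙-isCommutativeMonoid
  ; ◁-isMonoid            = ；-𝟙-isMonoid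
  ; ⅋-mono                = IsContextual.mono ⅋-isContextual
  ; ◁-mono                = IsContextual.mono ；-isContextual
  ; +-mono                = IsContextual.mono &-isContextual
  ; ⅋-◁                   = λ _ _ _ _ → by-⟶ sequence
  ; +-⅋                   = λ _ _ _ → by-⟶ external
  ; +-◁                   = λ _ _ _ _ → by-⟶ medial
  ; i+i                   = by-⟶ tidy
  }
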